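{- Let $K$ be an even integer and $x\ge1$ an integer. Then $\pi_K(2^x)=\alpha_K(2^x)=2^{\,x+1-\nu_2(\gcd(2^x,K))}$ and $\omega_K(2^x)=1$.
   Context: $\nu_2$ denotes the 2-adic valuation. For an integer $K$, the $K$-Fibonacci sequence is $F_{K,0}=0$, $F_{K,1}=1$, $F_{K,n}=KF_{K,n-1}+F_{K,n-2}$ for $n\ge2$. For an integer $m\ge 2$, $\pi_K(m)$ is the least positive period of $(F_{K,n}\bmod m)$, $\alpha_K(m)$ is the least positive index $n$ with $m\mid F_{K,n}$, and $\omega_K(m)$ is the number of indices $0\le n<\pi_K(m)$ with $m\mid F_{K,n}$. -}

module Defs where

open import Data.Nat as ℕ using (ℕ; zero; suc; _≤_; _<_)
import Data.Nat.Divisibility as ℕD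
open import Data.Integer as ℤ using (ℤ; +_)
open import Data.Integer.Divisibility using (_∣_)
open import Data.Bool using (if_then_else_)
open import Relation.Nullary using (¬_; does)
open import Data.Product using (_×_)

F : ℤ → ℕ → ℤ
F K zero = + 0
F K (suc zero) = + 1
F K (suc (suc n)) = K ℤ.* F K (suc n) ℤ.+ F K n

IsPeriod : ℤ → ℕ → ℕ → Set
IsPeriod K m p = 0 < p × (∀ n → (+ m) ∣ (F K (n ℕ.+ p) ℤ.- F K n))

IsPi : ℤ → ℕ → ℕ → Set
IsPi K m p = IsPeriod K m p × (∀ q → IsPeriod K m q → p ≤ q)

IsAlpha : ℤ → ℕ → ℕ → Set
IsAlpha K m a = 0 < a × (+ m) ∣ F K a × (∀ b → 0 < b → (+ m) ∣ F K b → a ≤ b)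

-- number of indices 0 ≤ n < p with m ∣ F K n
-- (integer divisibility (+ m) ∣ i is by definition m ∣ ∣ i ∣ in ℕ)
countZeros : ℤ → ℕ → ℕ → ℕ
countZeros K m zero = 0
countZeros K m (suc p) =
  (if does (m ℕD.∣? ℤ.∣ F K p ∣) then 1 else 0) ℕ.+ countZeros K m p

-- 2-adic valuation of a natural number (fuel-based; ν₂ 0 = 0 by convention,
-- only ever applied to positive numbers here)
ν₂-aux : ℕ → ℕ → ℕ
ν₂-aux zero n = 0
ν₂-aux (suc fuel) zero = 0
ν₂-aux (suc fuel) (suc k) =
  if does (2 ℕD.∣? suc k) then suc (ν₂-aux fuel (suc k ℕ./ 2)) else 0

ν₂ : ℕ → ℕ
ν₂ n = ν₂-aux n n

private
  open import Relation.Binary.PropositionalEquality using (_≡_; refl)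
  _ : ν₂ 12 ≡ 2
  _ = refl
  _ : ν₂ 8 ≡ 3
  _ = refl
  _ : F (+ 2) 4 ≡ + 12
  _ = refl
  _ : countZeros (+ 2) 4 4 ≡ 1
  _ = refl

{-# OPTIONS --safe #-}
module Submission where

-- By the addition formula F(m+n+1) = F(m+1) F(n+1) + F(m) F(n), if
-- F(N) ≡ 0 and F(N-1) ≡ 1 (mod m) then N is a period; if moreover m divides no F(b)
-- with 0 < b < N, then N is at once the least period and the rank of apparition, and
-- a period contains exactly one zero. For m = 2^x with 2^x ∣ K take N = 2 (F(2) = K).
-- Otherwise K = 2^k·u with u odd and 1 ≤ k < x. From F(2n) = F(n)·V(n), where
-- V(n) = F(n+1) + F(n-1) has 2-adic valuation k for odd n and 1 for even n, one gets
-- ν₂(F(n)) = 0 for odd n and ν₂(F(n)) = ν₂(n) + k - 1 for even n. So the first n with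
-- 2^x ∣ F(n) is N = 2^(x+1-k), and F(N-1) ≡ 1 (mod 2^x) follows by induction from
-- F(2d+1) - 1 = F(d+1)² + (F(d) + 1)(F(d) - 1). Finally gcd(2^x, K) = 2^min(x,k).

open import Defs
open import Data.Nat using (ℕ; _+_; _∸_; _^_; _≤_)
open import Data.Nat.GCD using (gcd)
open import Data.Integer using (ℤ; +_; ∣_∣)
open import Data.Integer.Divisibility using (_∣_)
open import Data.Product using (_×_)
open import Relation.Binary.PropositionalEquality using (_≡_)

open import Data.Nat using (zero; suc; _*_; _<_; z≤n; s≤s; z<s; NonZero)
open import Data.Nat.Properties
import Data.Nat.Divisibility as ℕ
open import Data.Nat.DivMod using (_/_; m*n/n≡m)
open import Data.Nat.GCD using (gcd[m,n]∣m; gcd-greatest; c*gcd[m,n]≡gcd[cm,cn])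
open import Data.Nat.Coprimality using (Coprime; coprime-divisor; coprime⇒gcd≡1; 1-coprimeTo)
open import Data.Nat.Primality using (irreducible[2])
open import Data.Nat.Induction using (<-rec)
import Data.Integer as ℤ
import Data.Integer.Properties as ℤ
open import Data.Integer.DivMod using (_%ℕ_; _/ℕ_; a≡a%ℕn+[a/ℕn]*n; n%ℕd<d)
import Data.Integer.Divisibility.Signed as Signed
open import Data.Integer.Tactic.RingSolver using (solve-∀)
open import Data.Product using (_,_; ∃-syntax; map)
open import Data.Sum using (_⊎_; inj₁; inj₂)
open import Data.Bool using (if_then_else_)
open import Function using (_∘_)
open import Relation.Nullary using (¬_; contradiction)
open import Relation.Nullary.Decidable using (dec-true; dec-false)
open import Relation.Binary.PropositionalEquality
  using (refl; sym; trans; cong; cong₂; subst; subst₂; module ≡-Reasoning)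

F-add : ∀ K m n → F K (suc (m + n)) ≡ F K (suc m) ℤ.* F K (suc n) ℤ.+ F K m ℤ.* F K n
F-add K zero n = identity (F K (suc n)) (F K n)
  where
  identity : ∀ a b → a ≡ + 1 ℤ.* a ℤ.+ + 0 ℤ.* b
  identity = solve-∀
F-add K (suc zero) n = identity K (F K (suc n)) (F K n)
  where
  identity : ∀ k a b → k ℤ.* a ℤ.+ b ≡ (k ℤ.* + 1 ℤ.+ + 0) ℤ.* a ℤ.+ + 1 ℤ.* b
  identity = solve-∀
F-add K (suc (suc m)) n =
  trans (cong₂ (λ a b → K ℤ.* a ℤ.+ b) (F-add K (suc m) n) (F-add K m n))
        (identity K (F K (suc (suc m))) (F K (suc m)) (F K m) (F K (suc n)) (F K n))
  where
  identity : ∀ k a b c x y → k ℤ.* (a ℤ.* x ℤ.+ b ℤ.* y) ℤ.+ (b ℤ.* x ℤ.+ c ℤ.* y)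
                             ≡ (k ℤ.* a ℤ.+ b) ℤ.* x ℤ.+ (k ℤ.* b ℤ.+ c) ℤ.* y
  identity = solve-∀

-- The companion Lucas number V_{p+1} = F_{p+2} + F_p.
lucas : ℤ → ℕ → ℤ
lucas K p = K ℤ.* F K (suc p) ℤ.+ + 2 ℤ.* F K p

F-double : ∀ K p → F K (suc (suc (p + p))) ≡ F K (suc p) ℤ.* lucas K p
F-double K p = begin
  F K (suc (suc (p + p)))
    ≡⟨ cong (F K ∘ suc) (sym (+-suc p p)) ⟩
  F K (suc (p + suc p))
    ≡⟨ F-add K p (suc p) ⟩
  F K (suc p) ℤ.* F K (suc (suc p)) ℤ.+ F K p ℤ.* F K (suc p)
    ≡⟨ identity K (F K (suc p)) (F K p) ⟩
  F K (suc p) ℤ.* lucas K p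
    ∎
  where
  open ≡-Reasoning
  identity : ∀ k a b → a ℤ.* (k ℤ.* a ℤ.+ b) ℤ.+ b ℤ.* a ≡ a ℤ.* (k ℤ.* a ℤ.+ + 2 ℤ.* b)
  identity = solve-∀

F[2d+1]-1 : ∀ K d → F K (suc (d + d)) ℤ.- + 1
                   ≡ F K (suc d) ℤ.* F K (suc d) ℤ.+ (F K d ℤ.+ + 1) ℤ.* (F K d ℤ.- + 1)
F[2d+1]-1 K d = trans (cong (ℤ._- + 1) (F-add K d d)) (identity (F K (suc d)) (F K d))
  where
  identity : ∀ a b → a ℤ.* a ℤ.+ b ℤ.* b ℤ.- + 1 ≡ a ℤ.* a ℤ.+ (b ℤ.+ + 1) ℤ.* (b ℤ.- + 1)
  identity = solve-∀

F-shift : ∀ K M n → F K (n + suc M) ℤ.- F K n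
                    ≡ F K (suc n) ℤ.* F K (suc M) ℤ.+ F K n ℤ.* (F K M ℤ.- + 1)
F-shift K M n = begin
  F K (n + suc M) ℤ.- F K n
    ≡⟨ cong (λ i → F K i ℤ.- F K n) (+-suc n M) ⟩
  F K (suc (n + M)) ℤ.- F K n
    ≡⟨ cong (ℤ._- F K n) (F-add K n M) ⟩
  F K (suc n) ℤ.* F K (suc M) ℤ.+ F K n ℤ.* F K M ℤ.- F K n
    ≡⟨ identity (F K (suc n)) (F K (suc M)) (F K n) (F K M) ⟩
  F K (suc n) ℤ.* F K (suc M) ℤ.+ F K n ℤ.* (F K M ℤ.- + 1)
    ∎
  where
  open ≡-Reasoning
  identity : ∀ a b c e → a ℤ.* b ℤ.+ c ℤ.* e ℤ.- c ≡ a ℤ.* b ℤ.+ c ℤ.* (e ℤ.- + 1)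
  identity = solve-∀

PeriodRankOmega : ℤ → ℕ → ℕ → Set
PeriodRankOmega K m N = IsPi K m N × IsAlpha K m N × countZeros K m N ≡ 1

ZeroFreeBelow : ℤ → ℕ → ℕ → Set
ZeroFreeBelow K m N = ∀ b → 0 < b → b < N → ¬ (+ m ∣ F K b)

module _ {K : ℤ} {m : ℕ} where

  restart⇒isPeriod : ∀ {M} → + m Signed.∣ F K (suc M) → + m Signed.∣ F K M ℤ.- + 1 →
                     IsPeriod K m (suc M)
  restart⇒isPeriod {M} m∣F[1+M] m∣F[M]-1 = z<s , λ n →
    Signed.∣⇒∣ᵤ (subst (+ m Signed.∣_) (sym (F-shift K M n))
      (Signed.∣m∣n⇒∣m+n (Signed.∣n⇒∣m*n (F K (suc n)) m∣F[1+M])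
                        (Signed.∣n⇒∣m*n (F K n) m∣F[M]-1)))

  zeroFree⇒≤ : ∀ {N b} → ZeroFreeBelow K m N → 0 < b → + m ∣ F K b → N ≤ b
  zeroFree⇒≤ zf 0<b m∣F[b] = ≮⇒≥ (λ b<N → zf _ 0<b b<N m∣F[b])

  isPi : ∀ {N} → IsPeriod K m N → ZeroFreeBelow K m N → IsPi K m N
  isPi per zf = per , λ q (0<q , q-periodic) →
    zeroFree⇒≤ zf 0<q (subst (λ z → + m ∣ z) (ℤ.+-identityʳ (F K q)) (q-periodic 0))

  isAlpha : ∀ {N} → 0 < N → + m ∣ F K N → ZeroFreeBelow K m N → IsAlpha K m N
  isAlpha 0<N m∣F[N] zf = 0<N , m∣F[N] , λ b 0<b → zeroFree⇒≤ zf 0<b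

  countZeros≡1 : ∀ {N p} → ZeroFreeBelow K m N → 0 < p → p ≤ N → countZeros K m p ≡ 1
  countZeros≡1 {p = 1} _ _ _ = cong (λ b → (if b then 1 else 0) + 0) (dec-true (m ℕ.∣? 0) (m ℕ.∣0))
  countZeros≡1 {p = suc (suc p)} zf _ 2+p≤N =
    cong₂ (λ b c → (if b then 1 else 0) + c)
          (dec-false (m ℕ.∣? ∣ F K (suc p) ∣) (zf (suc p) z<s 2+p≤N))
          (countZeros≡1 zf z<s (<⇒≤ 2+p≤N))

  periodRankOmega : ∀ {M} → + m Signed.∣ F K (suc M) → + m Signed.∣ F K M ℤ.- + 1 →
                    ZeroFreeBelow K m (suc M) → PeriodRankOmega K m (suc M)
  periodRankOmega m∣F[1+M] m∣F[M]-1 zf =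
    isPi (restart⇒isPeriod m∣F[1+M] m∣F[M]-1) zf ,
    isAlpha z<s (Signed.∣⇒∣ᵤ m∣F[1+M]) zf ,
    countZeros≡1 zf z<s ≤-refl

infix 4 2^_∣_ 2^_∥_

-- A record rather than + (2 ^ e) Signed.∣ z, so that the exponent e can be inferred.
record 2^_∣_ (e : ℕ) (z : ℤ) : Set where
  constructor divides
  field
    quotient : ℤ
    equality : z ≡ quotient ℤ.* + (2 ^ e)

record 2^_∥_ (e : ℕ) (z : ℤ) : Set where
  constructor exactly
  field
    r : ℤ
    equality : z ≡ (+ 1 ℤ.+ + 2 ℤ.* r) ℤ.* + (2 ^ e)

2^-+ : ∀ e f → + (2 ^ (e + f)) ≡ + (2 ^ e) ℤ.* + (2 ^ f)
2^-+ e f = trans (cong +_ (^-distribˡ-+-* 2 e f)) (ℤ.pos-* (2 ^ e) (2 ^ f))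

2^∣⇒∣ : ∀ {e z} → 2^ e ∣ z → + (2 ^ e) Signed.∣ z
2^∣⇒∣ (divides q eq) = Signed.divides q eq

∣⇒2^∣ : ∀ {e z} → + (2 ^ e) ∣ z → 2^ e ∣ z
∣⇒2^∣ 2^e∣z with Signed.divides q eq ← Signed.∣ᵤ⇒∣ 2^e∣z = divides q eq

2^∣-refl : ∀ {e} → 2^ e ∣ + (2 ^ e)
2^∣-refl {e} = divides (+ 1) (sym (ℤ.*-identityˡ (+ (2 ^ e))))

2^∣-+ : ∀ {e x y} → 2^ e ∣ x → 2^ e ∣ y → 2^ e ∣ x ℤ.+ y
2^∣-+ {e} (divides a refl) (divides b refl) = divides (a ℤ.+ b) (sym (ℤ.*-distribʳ-+ (+ (2 ^ e)) a b))

2^∣-*ʳ : ∀ {e x} y → 2^ e ∣ x → 2^ e ∣ x ℤ.* y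
2^∣-*ʳ {e} y (divides a refl) = divides (a ℤ.* y) (identity a (+ (2 ^ e)) y)
  where
  identity : ∀ a t y → a ℤ.* t ℤ.* y ≡ a ℤ.* y ℤ.* t
  identity = solve-∀

2^∣-weaken : ∀ {e f z} → e ≤ f → 2^ f ∣ z → 2^ e ∣ z
2^∣-weaken {e} {f} e≤f (divides q refl) = divides (q ℤ.* + (2 ^ (f ∸ e))) (begin
  q ℤ.* + (2 ^ f)                           ≡⟨ cong (λ i → q ℤ.* + (2 ^ i)) (sym (m∸n+n≡m e≤f)) ⟩
  q ℤ.* + (2 ^ (f ∸ e + e))                 ≡⟨ cong (q ℤ.*_) (2^-+ (f ∸ e) e) ⟩
  q ℤ.* (+ (2 ^ (f ∸ e)) ℤ.* + (2 ^ e))     ≡⟨ ℤ.*-assoc q _ _ ⟨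
  q ℤ.* + (2 ^ (f ∸ e)) ℤ.* + (2 ^ e)       ∎)
  where open ≡-Reasoning

2^∣-* : ∀ {e f x y} → 2^ e ∣ x → 2^ f ∣ y → 2^ (e + f) ∣ x ℤ.* y
2^∣-* {e} {f} (divides a refl) (divides b refl) =
  divides (a ℤ.* b) (trans (identity a b (+ (2 ^ e)) (+ (2 ^ f))) (cong ((a ℤ.* b) ℤ.*_) (sym (2^-+ e f))))
  where
  identity : ∀ a b s t → (a ℤ.* s) ℤ.* (b ℤ.* t) ≡ (a ℤ.* b) ℤ.* (s ℤ.* t)
  identity = solve-∀

∥⇒∣ : ∀ {e z} → 2^ e ∥ z → 2^ e ∣ z
∥⇒∣ (exactly r eq) = divides (+ 1 ℤ.+ + 2 ℤ.* r) eq

∥-* : ∀ {e f x y} → 2^ e ∥ x → 2^ f ∥ y → 2^ (e + f) ∥ x ℤ.* y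
∥-* {e} {f} (exactly r refl) (exactly s refl) =
  exactly (r ℤ.+ s ℤ.+ + 2 ℤ.* r ℤ.* s)
    (trans (identity (+ (2 ^ e)) (+ (2 ^ f)) r s)
           (cong ((+ 1 ℤ.+ + 2 ℤ.* (r ℤ.+ s ℤ.+ + 2 ℤ.* r ℤ.* s)) ℤ.*_) (sym (2^-+ e f))))
  where
  identity : ∀ a b r s → ((+ 1 ℤ.+ + 2 ℤ.* r) ℤ.* a) ℤ.* ((+ 1 ℤ.+ + 2 ℤ.* s) ℤ.* b)
                         ≡ (+ 1 ℤ.+ + 2 ℤ.* (r ℤ.+ s ℤ.+ + 2 ℤ.* r ℤ.* s)) ℤ.* (a ℤ.* b)
  identity = solve-∀

∣-+-∥ : ∀ {e x y} → 2^ suc e ∣ x → 2^ e ∥ y → 2^ e ∥ x ℤ.+ y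
∣-+-∥ {e} (divides q refl) (exactly r refl) =
  exactly (q ℤ.+ r)
    (trans (cong (λ t → q ℤ.* t ℤ.+ (+ 1 ℤ.+ + 2 ℤ.* r) ℤ.* + (2 ^ e)) (ℤ.pos-* 2 (2 ^ e)))
           (identity q r (+ (2 ^ e))))
  where
  identity : ∀ q r t → q ℤ.* (+ 2 ℤ.* t) ℤ.+ (+ 1 ℤ.+ + 2 ℤ.* r) ℤ.* t
                       ≡ (+ 1 ℤ.+ + 2 ℤ.* (q ℤ.+ r)) ℤ.* t
  identity = solve-∀

∥-+-∣ : ∀ {e x y} → 2^ e ∥ x → 2^ suc e ∣ y → 2^ e ∥ x ℤ.+ y
∥-+-∣ {x = x} {y} 2^e∥x 2^[1+e]∣y = subst (2^ _ ∥_) (ℤ.+-comm y x) (∣-+-∥ 2^[1+e]∣y 2^e∥x)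

∥⇒∤ : ∀ {e f z} → 2^ e ∥ z → e < f → ¬ 2^ f ∣ z
∥⇒∤ {e} (exactly r refl) e<f 2^f∣z
  with divides q eq ← 2^∣-weaken e<f 2^f∣z
  = contradiction (ℕ.∣1⇒≡1 (Signed.∣⇒∣ᵤ 2∣1)) λ ()
  where
  odd≡q*2 : + 1 ℤ.+ + 2 ℤ.* r ≡ q ℤ.* + 2
  odd≡q*2 = ℤ.*-cancelʳ-≡ _ _ (+ (2 ^ e)) {{m^n≢0 2 e}}
    (trans eq (trans (cong (q ℤ.*_) (ℤ.pos-* 2 (2 ^ e))) (sym (ℤ.*-assoc q (+ 2) (+ (2 ^ e))))))
  2∣1 : + 2 Signed.∣ + 1
  2∣1 = Signed.∣m+n∣n⇒∣m (Signed.divides q odd≡q*2) (Signed.∣m⇒∣m*n r Signed.∣-refl)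

ℤ-even-or-odd : ∀ q → ∃[ r ] (q ≡ r ℤ.* + 2 ⊎ q ≡ + 1 ℤ.+ + 2 ℤ.* r)
ℤ-even-or-odd q with q %ℕ 2 | a≡a%ℕn+[a/ℕn]*n q 2 | n%ℕd<d q 2
... | 0 | q≡ | _ = q /ℕ 2 , inj₁ (trans q≡ (ℤ.+-identityˡ _))
... | 1 | q≡ | _ = q /ℕ 2 , inj₂ (trans q≡ (cong (λ t → + 1 ℤ.+ t) (ℤ.*-comm (q /ℕ 2) (+ 2))))
... | suc (suc _) | _ | s≤s (s≤s ())

2^∣⊎∥ : ∀ x K → 2^ x ∣ K ⊎ ∃[ k ] k < x × 2^ k ∥ K
2^∣⊎∥ zero K = inj₁ (divides K (sym (ℤ.*-identityʳ K)))
2^∣⊎∥ (suc x) K with 2^∣⊎∥ x K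
... | inj₂ (k , k<x , 2^k∥K) = inj₂ (k , m≤n⇒m≤1+n k<x , 2^k∥K)
... | inj₁ (divides q K≡q*2^x) with ℤ-even-or-odd q
...   | r , inj₁ refl = inj₁ (divides r (trans K≡q*2^x (trans (ℤ.*-assoc r (+ 2) (+ (2 ^ x)))
                                                              (cong (r ℤ.*_) (sym (ℤ.pos-* 2 (2 ^ x)))))))
...   | r , inj₂ refl = inj₂ (x , ≤-refl , exactly r K≡q*2^x)

odd⇒coprime-2 : ∀ {d} → ¬ 2 ℕ.∣ d → Coprime d 2
odd⇒coprime-2 2∤d (c∣d , c∣2) with irreducible[2] c∣2
... | inj₁ c≡1 = c≡1
... | inj₂ refl = contradiction c∣d 2∤d

coprime-2^-odd : ∀ {w} → ¬ 2 ℕ.∣ w → ∀ j → Coprime (2 ^ j) w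
coprime-2^-odd {w} _ zero = 1-coprimeTo w
coprime-2^-odd 2∤w (suc j) {d} (d∣2^[1+j] , d∣w) =
  coprime-2^-odd 2∤w j (coprime-divisor d⊥2 d∣2^[1+j] , d∣w)
  where
  d⊥2 : Coprime d 2
  d⊥2 = odd⇒coprime-2 (λ 2∣d → 2∤w (ℕ.∣-trans 2∣d d∣w))

gcd[2^x,∣K∣]-∣ : ∀ {x K} → 2^ x ∣ K → gcd (2 ^ x) ∣ K ∣ ≡ 2 ^ x
gcd[2^x,∣K∣]-∣ {x} {K} 2^x∣K =
  ℕ.∣-antisym (gcd[m,n]∣m (2 ^ x) ∣ K ∣) (gcd-greatest ℕ.∣-refl (Signed.∣⇒∣ᵤ (2^∣⇒∣ 2^x∣K)))

gcd[2^x,∣K∣]-∥ : ∀ {x K k} → 2^ k ∥ K → k ≤ x → gcd (2 ^ x) ∣ K ∣ ≡ 2 ^ k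
gcd[2^x,∣K∣]-∥ {x} {K} {k} (exactly r refl) k≤x = begin
  gcd (2 ^ x) ∣ K ∣                         ≡⟨ cong₂ gcd 2^x≡ ∣K∣≡ ⟩
  gcd (2 ^ k * 2 ^ (x ∸ k)) (2 ^ k * w)     ≡⟨ c*gcd[m,n]≡gcd[cm,cn] (2 ^ k) _ _ ⟨
  2 ^ k * gcd (2 ^ (x ∸ k)) w               ≡⟨ cong (2 ^ k *_) (coprime⇒gcd≡1 (coprime-2^-odd 2∤w (x ∸ k))) ⟩
  2 ^ k * 1                                 ≡⟨ *-identityʳ (2 ^ k) ⟩
  2 ^ k                                     ∎
  where
  open ≡-Reasoning
  w : ℕ
  w = ∣ + 1 ℤ.+ + 2 ℤ.* r ∣
  2^x≡ : 2 ^ x ≡ 2 ^ k * 2 ^ (x ∸ k)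
  2^x≡ = trans (cong (2 ^_) (sym (m+[n∸m]≡n k≤x))) (^-distribˡ-+-* 2 k (x ∸ k))
  ∣K∣≡ : ∣ K ∣ ≡ 2 ^ k * w
  ∣K∣≡ = trans (ℤ.abs-* (+ 1 ℤ.+ + 2 ℤ.* r) (+ (2 ^ k))) (*-comm w (2 ^ k))
  2∤w : ¬ 2 ℕ.∣ w
  2∤w 2∣w = ∥⇒∤ {z = + 1 ℤ.+ + 2 ℤ.* r} (exactly r (sym (ℤ.*-identityʳ _))) z<s (∣⇒2^∣ {1} 2∣w)

-- Valuation₂ j n : n = 2 ^ j · odd. The indices are kept in successor form so that
-- F-double applies to them without rewriting.
data Valuation₂ : ℕ → ℕ → Set where
  odd    : ∀ r → Valuation₂ 0 (suc (r + r))
  double : ∀ {j p} → Valuation₂ j (suc p) → Valuation₂ (suc j) (suc (suc (p + p)))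

even-or-odd : ∀ n → ∃[ h ] (n ≡ h + h ⊎ n ≡ suc (h + h))
even-or-odd zero = 0 , inj₁ refl
even-or-odd (suc n) with even-or-odd n
... | h , inj₁ refl = h , inj₂ refl
... | h , inj₂ refl = suc h , inj₁ (cong suc (sym (+-suc h h)))

valuation₂ : ∀ p → ∃[ j ] Valuation₂ j (suc p)
valuation₂ = <-rec (λ p → ∃[ j ] Valuation₂ j (suc p)) step
  where
  step : ∀ p → (∀ {q} → q < p → ∃[ j ] Valuation₂ j (suc q)) → ∃[ j ] Valuation₂ j (suc p)
  step p rec with even-or-odd p
  ... | r , inj₁ refl = 0 , odd r
  ... | q , inj₂ refl = map suc double (rec (s≤s (m≤m+n q q)))

Valuation₂⇒2^≤ : ∀ {j n} → Valuation₂ j n → 2 ^ j ≤ n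
Valuation₂⇒2^≤ (odd r) = s≤s z≤n
Valuation₂⇒2^≤ (double {p = p} v) =
  ≤-trans (*-monoʳ-≤ 2 (Valuation₂⇒2^≤ v)) (≤-reflexive 2*[1+p]≡2+p+p)
  where
  2*[1+p]≡2+p+p : 2 * suc p ≡ suc (suc (p + p))
  2*[1+p]≡2+p+p = cong suc (trans (+-suc p (p + 0)) (cong (λ i → suc (p + i)) (+-identityʳ p)))

mersenne : ℕ → ℕ
mersenne zero = 0
mersenne (suc j) = suc (mersenne j + mersenne j)

suc-mersenne : ∀ j → suc (mersenne j) ≡ 2 ^ j
suc-mersenne zero = refl
suc-mersenne (suc j) = begin
  suc (suc (mersenne j + mersenne j))      ≡⟨ cong suc (sym (+-suc (mersenne j) (mersenne j))) ⟩
  suc (mersenne j) + suc (mersenne j)      ≡⟨ cong₂ _+_ (suc-mersenne j) (suc-mersenne j) ⟩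
  2 ^ j + 2 ^ j                            ≡⟨ cong (λ i → 2 ^ j + i) (sym (+-identityʳ (2 ^ j))) ⟩
  2 ^ suc j                                ∎
  where open ≡-Reasoning

valuation₂-2^ : ∀ j → Valuation₂ j (suc (mersenne j))
valuation₂-2^ zero = odd 0
valuation₂-2^ (suc j) = double (valuation₂-2^ j)

n<2^n : ∀ n → n < 2 ^ n
n<2^n zero = z<s
n<2^n (suc n) = subst (suc (suc n) ≤_) (cong (λ i → 2 ^ n + i) (sym (+-identityʳ (2 ^ n))))
                      (+-mono-≤ (m^n>0 2 n) (n<2^n n))

ν₂-aux-2* : ∀ fuel n .{{_ : NonZero n}} → ν₂-aux (suc fuel) (2 * n) ≡ suc (ν₂-aux fuel n)
ν₂-aux-2* fuel (suc n) rewrite dec-true (2 ℕ.∣? 2 * suc n) (ℕ.m∣m*n (suc n)) =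
  cong (suc ∘ ν₂-aux fuel) (trans (cong (_/ 2) (*-comm 2 (suc n))) (m*n/n≡m (suc n) 2))

ν₂-aux-2^ : ∀ {fuel} v → v < fuel → ν₂-aux fuel (2 ^ v) ≡ v
ν₂-aux-2^ {suc fuel} zero _ = refl
ν₂-aux-2^ {suc fuel} (suc v) (s≤s v<fuel) =
  trans (ν₂-aux-2* fuel (2 ^ v) {{m^n≢0 2 v}}) (cong suc (ν₂-aux-2^ v v<fuel))

ν₂-2^ : ∀ v → ν₂ (2 ^ v) ≡ v
ν₂-2^ v = ν₂-aux-2^ v (n<2^n v)

2^∣K⇒2^∣F[p+p] : ∀ {K e} → 2^ e ∣ K → ∀ p → 2^ e ∣ F K (p + p)
2^∣K⇒2^∣F[p+p] _ zero = divides (+ 0) refl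
2^∣K⇒2^∣F[p+p] {K} 2^e∣K (suc p) rewrite +-suc p p =
  2^∣-+ (2^∣-*ʳ (F K (suc (p + p))) 2^e∣K) (2^∣K⇒2^∣F[p+p] 2^e∣K p)

F[p+p+1]-odd : ∀ {K} → 2^ 1 ∣ K → ∀ p → 2^ 0 ∥ F K (suc (p + p))
F[p+p+1]-odd _ zero = exactly (+ 0) refl
F[p+p+1]-odd {K} 2∣K (suc p) rewrite +-suc p p =
  ∣-+-∥ (2^∣-*ʳ (F K (suc (suc (p + p)))) 2∣K) (F[p+p+1]-odd 2∣K p)

lucas[r+r]-∥ : ∀ {K k} → 2^ 1 ∣ K → 2^ k ∥ K → ∀ r → 2^ k ∥ lucas K (r + r)
lucas[r+r]-∥ {K} {k} 2∣K 2^k∥K r =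
  ∥-+-∣ (subst (2^_∥ K ℤ.* F K (suc (r + r))) (+-identityʳ k) (∥-* 2^k∥K (F[p+p+1]-odd 2∣K r)))
        (2^∣-* {1} 2^∣-refl (2^∣K⇒2^∣F[p+p] (∥⇒∣ 2^k∥K) r))

lucas[q+q+1]-∥ : ∀ {K} → 2^ 1 ∣ K → ∀ q → 2^ 1 ∥ lucas K (suc (q + q))
lucas[q+q+1]-∥ {K} 2∣K q =
  ∣-+-∥ (2^∣-* 2∣K 2∣F[q+q+2]) (∥-* {1} (exactly (+ 0) refl) (F[p+p+1]-odd 2∣K q))
  where
  2∣F[q+q+2] : 2^ 1 ∣ F K (suc (suc (q + q)))
  2∣F[q+q+2] = subst (λ i → 2^ 1 ∣ F K i) (cong suc (+-suc q q)) (2^∣K⇒2^∣F[p+p] 2∣K (suc q))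

module _ {K : ℤ} {k : ℕ} (1≤k : 1 ≤ k) (2^k∥K : 2^ k ∥ K) where

  private
    2∣K : 2^ 1 ∣ K
    2∣K = 2^∣-weaken 1≤k (∥⇒∣ 2^k∥K)

  νF : ℕ → ℕ
  νF zero = 0
  νF (suc j) = j + k

  F-∥ : ∀ {j n} → Valuation₂ j n → 2^ νF j ∥ F K n
  F-∥ (odd r) = F[p+p+1]-odd 2∣K r
  F-∥ (double (odd r)) =
    subst (2^ k ∥_) (sym (F-double K (r + r)))
          (∥-* (F[p+p+1]-odd 2∣K r) (lucas[r+r]-∥ 2∣K 2^k∥K r))
  F-∥ (double {suc j} (double {p = p} v)) =
    subst₂ 2^_∥_ (+-comm (j + k) 1) (sym (F-double K (suc (p + p))))
           (∥-* (F-∥ (double v)) (lucas[q+q+1]-∥ 2∣K p))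

  νF< : ∀ {j s} → j ≤ s → νF j < s + k
  νF< {zero} {s} _ = ≤-trans 1≤k (m≤n+m k s)
  νF< {suc j} {suc s} (s≤s j≤s) = s≤s (+-monoˡ-≤ k j≤s)

  F-zeroFree : ∀ s → ZeroFreeBelow K (2 ^ (s + k)) (suc (mersenne (suc s)))
  F-zeroFree s (suc p) _ b<N 2^[s+k]∣F[b] with j , v ← valuation₂ p =
    ∥⇒∤ (F-∥ v) (νF< j≤s) (∣⇒2^∣ 2^[s+k]∣F[b])
    where
    j≤s : j ≤ s
    j≤s = ≮⇒≥ λ s<j → <⇒≱ (subst (suc p <_) (suc-mersenne (suc s)) b<N)
                              (≤-trans (^-monoʳ-≤ 2 s<j) (Valuation₂⇒2^≤ v))

  F[mersenne]≡1 : ∀ s → 2^ (s + k) ∣ F K (mersenne (suc s)) ℤ.- + 1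
  F[mersenne]≡1 zero = divides (+ 0) refl
  F[mersenne]≡1 (suc s) =
    subst (2^ suc (s + k) ∣_) (sym (F[2d+1]-1 K d)) (2^∣-+ square-term product-term)
    where
    d : ℕ
    d = mersenne (suc s)
    1≤s+k : 1 ≤ s + k
    1≤s+k = ≤-trans 1≤k (m≤n+m k s)
    2^[s+k]∣F[d+1] : 2^ (s + k) ∣ F K (suc d)
    2^[s+k]∣F[d+1] = ∥⇒∣ (F-∥ (valuation₂-2^ (suc s)))
    square-term : 2^ suc (s + k) ∣ F K (suc d) ℤ.* F K (suc d)
    square-term = 2^∣-weaken (+-monoˡ-≤ (s + k) 1≤s+k) (2^∣-* 2^[s+k]∣F[d+1] 2^[s+k]∣F[d+1])
    2∣F[d]+1 : 2^ 1 ∣ F K d ℤ.+ + 1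
    2∣F[d]+1 = subst (2^ 1 ∣_) (identity (F K d))
                     (2^∣-+ (2^∣-weaken 1≤s+k (F[mersenne]≡1 s)) 2^∣-refl)
      where
      identity : ∀ a → a ℤ.- + 1 ℤ.+ + 2 ≡ a ℤ.+ + 1
      identity = solve-∀
    product-term : 2^ suc (s + k) ∣ (F K d ℤ.+ + 1) ℤ.* (F K d ℤ.- + 1)
    product-term = 2^∣-* 2∣F[d]+1 (F[mersenne]≡1 s)

  periodRankOmega-∥ : ∀ {x} → k ≤ x → PeriodRankOmega K (2 ^ x) (2 ^ suc (x ∸ k))
  periodRankOmega-∥ {x} k≤x =
    subst₂ (λ e N → PeriodRankOmega K (2 ^ e) N) (m∸n+n≡m k≤x) (suc-mersenne (suc s))
      (periodRankOmega (2^∣⇒∣ (∥⇒∣ (F-∥ (valuation₂-2^ (suc s)))))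
                       (2^∣⇒∣ (F[mersenne]≡1 s)) (F-zeroFree s))
    where
    s : ℕ
    s = x ∸ k

periodRankOmega-∣ : ∀ {K x} → 2^ x ∣ K → 1 ≤ x → PeriodRankOmega K (2 ^ x) 2
periodRankOmega-∣ {K} {x} 2^x∣K 1≤x =
  periodRankOmega (2^∣⇒∣ (subst (2^ x ∣_) (identity K) 2^x∣K)) (Signed.divides (+ 0) refl) zeroFree
  where
  identity : ∀ k → k ≡ k ℤ.* + 1 ℤ.+ + 0
  identity = solve-∀
  zeroFree : ZeroFreeBelow K (2 ^ x) 2
  zeroFree 1 _ _ 2^x∣1 = ∥⇒∤ (exactly (+ 0) refl) 1≤x (∣⇒2^∣ 2^x∣1)
  zeroFree (suc (suc _)) _ (s≤s (s≤s ()))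

theorem4p28 : (K : ℤ) → (+ 2) ∣ K → (x : ℕ) → 1 ≤ x →
    IsPi K (2 ^ x) (2 ^ (x + 1 ∸ ν₂ (gcd (2 ^ x) ∣ K ∣)))
    × IsAlpha K (2 ^ x) (2 ^ (x + 1 ∸ ν₂ (gcd (2 ^ x) ∣ K ∣)))
    × countZeros K (2 ^ x) (2 ^ (x + 1 ∸ ν₂ (gcd (2 ^ x) ∣ K ∣))) ≡ 1
theorem4p28 K 2∣K x 1≤x with 2^∣⊎∥ x K
... | inj₁ 2^x∣K
  rewrite gcd[2^x,∣K∣]-∣ 2^x∣K | ν₂-2^ x | m+n∸m≡n x 1 = periodRankOmega-∣ 2^x∣K 1≤x
... | inj₂ (k , k<x , 2^k∥K)
  rewrite gcd[2^x,∣K∣]-∥ 2^k∥K (<⇒≤ k<x) | ν₂-2^ k | +-∸-comm 1 (<⇒≤ k<x) | +-comm (x ∸ k) 1 =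
  periodRankOmega-∥ 1≤k 2^k∥K (<⇒≤ k<x)
  where
  1≤k : 1 ≤ k
  1≤k = ≮⇒≥ λ k<1 → ∥⇒∤ 2^k∥K k<1 (∣⇒2^∣ 2∣K)
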